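{- For every rooted binary tree $\mathbf{T}$ with $n$ leaves and random length sequence $\mathcal{W}_\mathbf{T}=(W_2,\dots,W_n)$, there is at least one up-split sequence $s=(s_1,\dots,s_n)$ with $\mathbb{P}\{(0,W_2,\dots,W_n)=s\}>0$.
   Context: A rooted binary tree is a finite tree with exactly one vertex (the root) of degree $2$ and all other vertices of degree $3$ or $1$; all edges have length $1$. For a set $K$ of leaves, $\mathbf{W}_\mathbf{T}(K)$ is the number of edges of the smallest connected subgraph containing $K$; with $(Y_1,\dots,Y_n)$ a uniformly random ordering of the leaves, $W_k=\mathbf{W}_\mathbf{T}(\{Y_1,\dots,Y_k\})$ for $2\le k\le n$. Down-split sequences $(s_2,\dots,s_m)$: $(1)$ is down-split; for $m>2$, $s$ is down-split if $\{2\le k<m:s_k=2k-2\}\neq\emptyset$ and, with $k_s$ its minimum, $(s_2-1,\dots,s_{k_s}-1)$ and $(s_{k_s+1}-(2k_s-2),\dots,s_m-(2k_s-2))$ are down-split (re-indexed from $2$). Up-split sequences are increasing sequences of nonnegative integers $s=(s_1,\dots,s_n)$ defined recursively: $(0)$ is up-split; for $n>1$, $s$ is up-split if $\{1\le k<n:s_k=2k-2\}\neq\emptyset$ and, with $k_s$ its maximum (the splitting index), $(s_1,\dots,s_{k_s})$ is up-split and $(s_{k_s+1}-(2k_s-1),\dots,s_n-(2k_s-1))$ is down-split (indexed from $2$). -}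

module Defs where

open import Data.Nat using (ℕ; zero; suc; _+_; _*_; _∸_; _≤_; _<_; _<ᵇ_)
open import Data.Bool using (Bool; true; false; _∨_)
open import Data.Fin using (Fin; toℕ)
open import Data.List using (List; []; _∷_; map; take; drop; length; upTo)
open import Data.List.Relation.Unary.Linked using (Linked)
open import Data.Maybe using (Maybe; just; nothing)
open import Data.Product using (∃)
open import Function.Bundles using (_↔_; Inverse)
open import Relation.Binary.PropositionalEquality using (_≡_; _≢_)

-- A rooted binary tree (root of degree 2, other vertices of
-- degree 3 or 1) is exactly a full binary tree whose root is a 'node';
-- we use the inductive type below and take  node l r  for the tree.

data Tree : Set where
  leaf : Tree
  node : Tree → Tree → Tree

leaves : Tree → ℕ
leaves leaf       = 1
leaves (node l r) = leaves l + leaves r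

data Leaf : Tree → Set where
  here  : Leaf leaf
  left  : ∀ {l r} → Leaf l → Leaf (node l r)
  right : ∀ {l r} → Leaf r → Leaf (node l r)

anyLeaf : (t : Tree) → (Leaf t → Bool) → Bool
anyLeaf leaf       K = K here
anyLeaf (node l r) K = anyLeaf l (λ y → K (left y)) ∨ anyLeaf r (λ y → K (right y))

hang : (t : Tree) → (Leaf t → Bool) → ℕ
hang leaf       K = 0
hang (node l r) K = branch (anyLeaf l Kl) (hang l Kl) + branch (anyLeaf r Kr) (hang r Kr)
  where
    Kl = λ y → K (left y)
    Kr = λ y → K (right y)
    branch : Bool → ℕ → ℕ
    branch true  h = suc h
    branch false h = 0

-- W_T(K): number of edges of the smallest connected subgraph of t
-- containing the leaf set K.
span : (t : Tree) → (Leaf t → Bool) → ℕ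
span leaf       K = 0
span (node l r) K = go (anyLeaf l Kl) (anyLeaf r Kr)
  where
    Kl = λ y → K (left y)
    Kr = λ y → K (right y)
    go : Bool → Bool → ℕ
    go true  true  = hang (node l r) K
    go true  false = span l Kl
    go false true  = span r Kr
    go false false = 0

-- An ordering (Y_1,…,Y_n) of the leaves: a bijection Fin n ↔ Leaf t,
-- Y_i = to σ (i-1).  The set {Y_1,…,Y_k}:
firstK : (t : Tree) → (Fin (leaves t) ↔ Leaf t) → ℕ → (Leaf t → Bool)
firstK t σ k y = toℕ (Inverse.from σ y) <ᵇ k

Wseq : (t : Tree) → (Fin (leaves t) ↔ Leaf t) → List ℕ
Wseq t σ = map (λ i → span t (firstK t σ (2 + i))) (upTo (leaves t ∸ 1))

nth : List ℕ → ℕ → Maybe ℕ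
nth []       _       = nothing
nth (x ∷ xs) zero    = just x
nth (x ∷ xs) (suc i) = nth xs i

-- Down-split sequences (s_2,…,s_m), stored as the list [s_2,…,s_m];
-- s_k is at position k-2, m = length + 1.
data DownSplit : List ℕ → Set where
  base  : DownSplit (1 ∷ [])
  split : ∀ (ds : List ℕ) (k : ℕ) →
          2 ≤ k → k < suc (length ds) →
          nth ds (k ∸ 2) ≡ just (2 * k ∸ 2) →
          (∀ j → 2 ≤ j → j < k → nth ds (j ∸ 2) ≢ just (2 * j ∸ 2)) →
          DownSplit (map (λ x → x ∸ 1) (take (k ∸ 1) ds)) →
          DownSplit (map (λ x → x ∸ (2 * k ∸ 2)) (drop (k ∸ 1) ds)) →
          DownSplit ds

-- Up-split sequences (s_1,…,s_n), stored as [s_1,…,s_n]; s_k at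
-- position k-1; increasing = strictly increasing.
data UpSplit : List ℕ → Set where
  base  : UpSplit (0 ∷ [])
  split : ∀ (s : List ℕ) (k : ℕ) →
          Linked _<_ s →
          1 ≤ k → k < length s →
          nth s (k ∸ 1) ≡ just (2 * k ∸ 2) →
          (∀ j → k < j → j < length s → nth s (j ∸ 1) ≢ just (2 * j ∸ 2)) →
          UpSplit (take k s) →
          DownSplit (map (λ x → x ∸ (2 * k ∸ 1)) (drop k s)) →
          UpSplit s

-- Take Y₁ to be the leftmost leaf of l and Y₂ the leftmost leaf of r.  Every
-- later leaf set contains both, so its spanned subtree passes through the
-- root and W no longer sees where T is rooted: re-rooting T turns it into
-- node leaf Q with Y₁ as the lone leaf, Q being T with Y₁ cut off.  Choosing
-- the remaining leaves in depth-first order of Q gives W_{j+2} = 2 + h(j),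
-- where h(j) counts the edges joining the root of Q to its first j+1 leaves.
-- Since h(j) > 2j before the last leaf, the sequence (0, W₂, …) splits at
-- index 1, and its down-split part (1 + h(j))_j is handled by induction on
-- Q = node u v: it splits where the leaves of u are exhausted, h having
-- reached 2|u| − 2 there, and beyond that point h is shifted by exactly 2|u|.
module Submission where

open import Defs
open import Data.Nat using (ℕ; zero; suc; _+_; _*_; _∸_; _≤_; _<_; _<ᵇ_; z≤n; s≤s)
open import Data.Nat.Properties
open import Data.Nat.Tactic.RingSolver using (solve-∀)
open import Data.Bool using (Bool; true; false; _∨_)
open import Data.Bool.Properties using (∨-zeroʳ)
open import Data.Fin as Fin using (Fin; toℕ; _↑ˡ_; _↑ʳ_; splitAt)
open import Data.Fin.Properties
  using (toℕ-↑ˡ; toℕ-↑ʳ; splitAt-↑ˡ; splitAt-↑ʳ; splitAt⁻¹-↑ˡ; splitAt⁻¹-↑ʳ; toℕ-cast; cast-involutive)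
open import Data.Sum using (inj₁; inj₂; [_,_]′)
open import Data.Product using (∃; _,_)
open import Data.List using (List; []; _∷_; map; take; drop; length; applyUpTo)
open import Data.List.Properties using (map-applyUpTo; length-applyUpTo; map-upTo)
open import Data.List.Relation.Unary.Linked using (Linked; []; [-]; _∷_)
open import Data.Maybe using (just)
open import Data.Maybe.Properties using (just-injective)
open import Function using (_∘_)
open import Function.Bundles using (_↔_; Inverse; mk↔ₛ′)
open import Function.Construct.Composition using (_↔-∘_)
open import Function.Construct.Identity using (↔-id)
open import Function.Construct.Symmetry using (↔-sym)
open import Relation.Binary.PropositionalEquality
open import Relation.Nullary using (yes; no)

open Inverse using (to; from)

anyLeaf-true : ∀ t (K : Leaf t → Bool) y → K y ≡ true → anyLeaf t K ≡ true
anyLeaf-true leaf       K here      Ky = Ky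
anyLeaf-true (node l r) K (left y)  Ky rewrite anyLeaf-true l (K ∘ left) y Ky = refl
anyLeaf-true (node l r) K (right y) Ky rewrite anyLeaf-true r (K ∘ right) y Ky = ∨-zeroʳ _

anyLeaf-false : ∀ t (K : Leaf t → Bool) → (∀ y → K y ≡ false) → anyLeaf t K ≡ false
anyLeaf-false leaf       K K≡false = K≡false here
anyLeaf-false (node l r) K K≡false =
  cong₂ _∨_ (anyLeaf-false l _ (K≡false ∘ left)) (anyLeaf-false r _ (K≡false ∘ right))

anyLeaf-cong : ∀ t {K K′ : Leaf t → Bool} → (∀ y → K y ≡ K′ y) → anyLeaf t K ≡ anyLeaf t K′
anyLeaf-cong leaf       K≗K′ = K≗K′ here
anyLeaf-cong (node l r) K≗K′ = cong₂ _∨_ (anyLeaf-cong l (K≗K′ ∘ left)) (anyLeaf-cong r (K≗K′ ∘ right))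

-- The local function branch of hang, which cannot be named outside Defs.
edgeIf : Bool → ℕ → ℕ
edgeIf true  h = suc h
edgeIf false h = 0

hang-node : ∀ l r (K : Leaf (node l r) → Bool) →
  hang (node l r) K ≡ edgeIf (anyLeaf l (K ∘ left)) (hang l (K ∘ left))
                    + edgeIf (anyLeaf r (K ∘ right)) (hang r (K ∘ right))
hang-node l r K with anyLeaf l (K ∘ left) | anyLeaf r (K ∘ right)
... | true  | true  = refl
... | true  | false = refl
... | false | true  = refl
... | false | false = refl

hang-both : ∀ l r (K : Leaf (node l r) → Bool) →
  anyLeaf l (K ∘ left) ≡ true → anyLeaf r (K ∘ right) ≡ true →
  hang (node l r) K ≡ suc (hang l (K ∘ left)) + suc (hang r (K ∘ right))
hang-both l r K inL inR rewrite hang-node l r K | inL | inR = refl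

hang-leftNonempty : ∀ l r (K : Leaf (node l r) → Bool) → anyLeaf l (K ∘ left) ≡ true →
  hang (node l r) K ≡ suc (hang l (K ∘ left)) + edgeIf (anyLeaf r (K ∘ right)) (hang r (K ∘ right))
hang-leftNonempty l r K inL rewrite hang-node l r K | inL = refl

hang-leftOnly : ∀ l r (K : Leaf (node l r) → Bool) →
  anyLeaf l (K ∘ left) ≡ true → anyLeaf r (K ∘ right) ≡ false →
  hang (node l r) K ≡ suc (hang l (K ∘ left))
hang-leftOnly l r K inL outR rewrite hang-node l r K | inL | outR = +-identityʳ _

span-both : ∀ l r (K : Leaf (node l r) → Bool) →
  anyLeaf l (K ∘ left) ≡ true → anyLeaf r (K ∘ right) ≡ true →
  span (node l r) K ≡ suc (hang l (K ∘ left)) + suc (hang r (K ∘ right))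
span-both l r K inL inR rewrite inL | inR = hang-both l r K inL inR

hang-cong : ∀ t {K K′ : Leaf t → Bool} → (∀ y → K y ≡ K′ y) → hang t K ≡ hang t K′
hang-cong leaf       K≗K′ = refl
hang-cong (node l r) {K} {K′} K≗K′ =
  trans (hang-node l r K) (trans
    (cong₂ _+_ (cong₂ edgeIf (anyLeaf-cong l (K≗K′ ∘ left))  (hang-cong l (K≗K′ ∘ left)))
               (cong₂ edgeIf (anyLeaf-cong r (K≗K′ ∘ right)) (hang-cong r (K≗K′ ∘ right))))
    (sym (hang-node l r K′)))

span-cong : ∀ t {K K′ : Leaf t → Bool} → (∀ y → K y ≡ K′ y) → span t K ≡ span t K′
span-cong leaf       K≗K′ = refl
span-cong (node l r) {K} {K′} K≗K′
  with anyLeaf l (K ∘ left) | anyLeaf l (K′ ∘ left) | anyLeaf-cong l (K≗K′ ∘ left)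
     | anyLeaf r (K ∘ right) | anyLeaf r (K′ ∘ right) | anyLeaf-cong r (K≗K′ ∘ right)
... | true  | _ | refl | true  | _ | refl = hang-cong (node l r) K≗K′
... | true  | _ | refl | false | _ | refl = span-cong l (K≗K′ ∘ left)
... | false | _ | refl | true  | _ | refl = span-cong r (K≗K′ ∘ right)
... | false | _ | refl | false | _ | refl = refl

-- Depth-first order

leftmost : (t : Tree) → Leaf t
leftmost leaf       = here
leftmost (node l r) = left (leftmost l)

leaves-pos : ∀ t → 1 ≤ leaves t
leaves-pos leaf       = s≤s z≤n
leaves-pos (node l r) = ≤-trans (leaves-pos l) (m≤m+n _ _)

rank : (t : Tree) → Leaf t → ℕ
rank leaf       here      = 0
rank (node l r) (left y)  = rank l y
rank (node l r) (right y) = leaves l + rank r y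

rank-leftmost : ∀ t → rank t (leftmost t) ≡ 0
rank-leftmost leaf       = refl
rank-leftmost (node l r) = rank-leftmost l

rank<leaves : ∀ t y → rank t y < leaves t
rank<leaves leaf       here      = s≤s z≤n
rank<leaves (node l r) (left y)  = ≤-trans (rank<leaves l y) (m≤m+n _ _)
rank<leaves (node l r) (right y) = +-monoʳ-< (leaves l) (rank<leaves r y)

dfsTo : ∀ t → Fin (leaves t) → Leaf t
dfsTo leaf       i = here
dfsTo (node l r) i = [ left ∘ dfsTo l , right ∘ dfsTo r ]′ (splitAt (leaves l) i)

dfsFrom : ∀ t → Leaf t → Fin (leaves t)
dfsFrom leaf       here      = Fin.zero
dfsFrom (node l r) (left y)  = dfsFrom l y ↑ˡ leaves r
dfsFrom (node l r) (right y) = leaves l ↑ʳ dfsFrom r y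

dfsTo-dfsFrom : ∀ t y → dfsTo t (dfsFrom t y) ≡ y
dfsTo-dfsFrom leaf       here = refl
dfsTo-dfsFrom (node l r) (left y)
  rewrite splitAt-↑ˡ (leaves l) (dfsFrom l y) (leaves r) = cong left (dfsTo-dfsFrom l y)
dfsTo-dfsFrom (node l r) (right y)
  rewrite splitAt-↑ʳ (leaves l) (leaves r) (dfsFrom r y) = cong right (dfsTo-dfsFrom r y)

dfsFrom-dfsTo : ∀ t i → dfsFrom t (dfsTo t i) ≡ i
dfsFrom-dfsTo leaf       Fin.zero = refl
dfsFrom-dfsTo (node l r) i with splitAt (leaves l) i in eq
... | inj₁ j = trans (cong (_↑ˡ leaves r) (dfsFrom-dfsTo l j)) (splitAt⁻¹-↑ˡ eq)
... | inj₂ j = trans (cong (leaves l ↑ʳ_) (dfsFrom-dfsTo r j)) (splitAt⁻¹-↑ʳ eq)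

dfs : ∀ t → Fin (leaves t) ↔ Leaf t
dfs t = mk↔ₛ′ (dfsTo t) (dfsFrom t) (dfsTo-dfsFrom t) (dfsFrom-dfsTo t)

toℕ-dfsFrom : ∀ t y → toℕ (from (dfs t) y) ≡ rank t y
toℕ-dfsFrom leaf       here      = refl
toℕ-dfsFrom (node l r) (left y)  = trans (toℕ-↑ˡ (dfsFrom l y) (leaves r)) (toℕ-dfsFrom l y)
toℕ-dfsFrom (node l r) (right y) =
  trans (toℕ-↑ʳ (leaves l) (dfsFrom r y)) (cong (leaves l +_) (toℕ-dfsFrom r y))

dfsPrefix : (t : Tree) → ℕ → Leaf t → Bool
dfsPrefix t k y = rank t y <ᵇ k

dfsHang : Tree → ℕ → ℕ
dfsHang t j = hang t (dfsPrefix t (suc j))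

<ᵇ-true : ∀ {m n} → m < n → (m <ᵇ n) ≡ true
<ᵇ-true {zero}  {suc n} _         = refl
<ᵇ-true {suc m} {suc n} (s≤s m<n) = <ᵇ-true m<n

<ᵇ-false : ∀ {m n} → n ≤ m → (m <ᵇ n) ≡ false
<ᵇ-false {m}     {zero}  _         = refl
<ᵇ-false {suc m} {suc n} (s≤s n≤m) = <ᵇ-false n≤m

+-<ᵇ : ∀ c a b → (c + a <ᵇ c + b) ≡ (a <ᵇ b)
+-<ᵇ zero    a b = refl
+-<ᵇ (suc c) a b = +-<ᵇ c a b

leftmost∈dfsPrefix : ∀ t j → dfsPrefix t (suc j) (leftmost t) ≡ true
leftmost∈dfsPrefix t j = cong (_<ᵇ suc j) (rank-leftmost t)

anyLeaf-dfsPrefix : ∀ t j → anyLeaf t (dfsPrefix t (suc j)) ≡ true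
anyLeaf-dfsPrefix t j = anyLeaf-true t _ (leftmost t) (leftmost∈dfsPrefix t j)

2+hang-all : ∀ t (K : Leaf t → Bool) → (∀ y → K y ≡ true) → 2 + hang t K ≡ 2 * leaves t
2+hang-all leaf       K all = refl
2+hang-all (node l r) K all = begin
  2 + hang (node l r) K
    ≡⟨ cong (2 +_) (hang-both l r K (anyLeaf-true l _ (leftmost l) (all (left (leftmost l))))
                                    (anyLeaf-true r _ (leftmost r) (all (right (leftmost r))))) ⟩
  2 + (suc (hang l (K ∘ left)) + suc (hang r (K ∘ right)))
    ≡⟨ cong (suc ∘ suc) (+-suc (hang l (K ∘ left)) (suc (hang r (K ∘ right)))) ⟨
  (2 + hang l (K ∘ left)) + (2 + hang r (K ∘ right))
    ≡⟨ cong₂ _+_ (2+hang-all l _ (all ∘ left)) (2+hang-all r _ (all ∘ right)) ⟩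
  2 * leaves l + 2 * leaves r
    ≡⟨ *-distribˡ-+ 2 (leaves l) (leaves r) ⟨
  2 * leaves (node l r) ∎
  where open ≡-Reasoning

2+dfsHang-last : ∀ t j → suc j ≡ leaves t → 2 + dfsHang t j ≡ 2 * leaves t
2+dfsHang-last t j j+1≡n =
  2+hang-all t _ (λ y → <ᵇ-true (subst (rank t y <_) (sym j+1≡n) (rank<leaves t y)))

dfsHang-left : ∀ u v j → j < leaves u → dfsHang (node u v) j ≡ suc (dfsHang u j)
dfsHang-left u v j j<c = hang-leftOnly u v (dfsPrefix (node u v) (suc j)) (anyLeaf-dfsPrefix u j)
  (anyLeaf-false v _ (λ y → <ᵇ-false (≤-trans j<c (m≤m+n (leaves u) (rank v y)))))

dfsHang-right : ∀ u v i → dfsHang (node u v) (leaves u + i) ≡ 2 * leaves u + dfsHang v i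
dfsHang-right u v i = begin
  dfsHang (node u v) (c + i)
    ≡⟨ hang-both u v K (anyLeaf-true u _ (leftmost u) (all (leftmost u)))
                       (trans (anyLeaf-cong v shift) (anyLeaf-dfsPrefix v i)) ⟩
  suc (hang u (K ∘ left)) + suc (hang v (K ∘ right))
    ≡⟨ cong suc (+-suc (hang u (K ∘ left)) (hang v (K ∘ right))) ⟩
  (2 + hang u (K ∘ left)) + hang v (K ∘ right)
    ≡⟨ cong₂ _+_ (2+hang-all u _ all) (hang-cong v shift) ⟩
  2 * c + dfsHang v i ∎
  where
    open ≡-Reasoning
    c = leaves u
    K = dfsPrefix (node u v) (suc (c + i))
    all : ∀ y → K (left y) ≡ true
    all y = <ᵇ-true (≤-trans (rank<leaves u y) (≤-trans (m≤m+n c i) (n≤1+n _)))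
    shift : ∀ y → K (right y) ≡ dfsPrefix v (suc i) y
    shift y = trans (cong (c + rank v y <ᵇ_) (sym (+-suc c i))) (+-<ᵇ c (rank v y) (suc i))

data LeftOrRight (c : ℕ) : ℕ → Set where
  inLeft  : ∀ {j} → j < c → LeftOrRight c j
  inRight : ∀ i → LeftOrRight c (c + i)

leftOrRight : ∀ c j → LeftOrRight c j
leftOrRight c j with j <? c
... | yes j<c = inLeft j<c
... | no  j≮c = subst (LeftOrRight c) (m+[n∸m]≡n (≮⇒≥ j≮c)) (inRight (j ∸ c))

2*j≤dfsHang : ∀ t j → j < leaves t → 2 * j ≤ dfsHang t j
2*j≤dfsHang leaf       zero    _           = z≤n
2*j≤dfsHang leaf       (suc j) (s≤s ())
2*j≤dfsHang (node u v) j j<n with leftOrRight (leaves u) j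
... | inLeft j<c rewrite dfsHang-left u v j j<c = m≤n⇒m≤1+n (2*j≤dfsHang u j j<c)
... | inRight i rewrite dfsHang-right u v i | *-distribˡ-+ 2 (leaves u) i =
  +-monoʳ-≤ (2 * leaves u) (2*j≤dfsHang v i (+-cancelˡ-< (leaves u) i (leaves v) j<n))

2*j<dfsHang : ∀ t j → suc j < leaves t → 2 * j < dfsHang t j
2*j<dfsHang leaf       j (s≤s ())
2*j<dfsHang (node u v) j j+1<n with leftOrRight (leaves u) j
... | inLeft j<c rewrite dfsHang-left u v j j<c = s≤s (2*j≤dfsHang u j j<c)
... | inRight i rewrite dfsHang-right u v i | *-distribˡ-+ 2 (leaves u) i =
  +-monoʳ-< (2 * leaves u) (2*j<dfsHang v i (+-cancelˡ-< (leaves u) (suc i) (leaves v)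
    (subst (_< leaves u + leaves v) (sym (+-suc (leaves u) i)) j+1<n)))

dfsHang-< : ∀ t j → suc j < leaves t → dfsHang t j < dfsHang t (suc j)
dfsHang-< leaf       j (s≤s ())
dfsHang-< (node u v) j j+1<n with leftOrRight (leaves u) j
... | inRight i = begin-strict
  dfsHang (node u v) (c + i)        ≡⟨ dfsHang-right u v i ⟩
  2 * c + dfsHang v i               <⟨ +-monoʳ-< (2 * c) (dfsHang-< v i i+1<e) ⟩
  2 * c + dfsHang v (suc i)         ≡⟨ dfsHang-right u v (suc i) ⟨
  dfsHang (node u v) (c + suc i)    ≡⟨ cong (dfsHang (node u v)) (+-suc c i) ⟩
  dfsHang (node u v) (suc (c + i))  ∎
  where
    open ≤-Reasoning
    c = leaves u
    i+1<e = +-cancelˡ-< c (suc i) (leaves v) (subst (_< c + leaves v) (sym (+-suc c i)) j+1<n)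
... | inLeft j<c with suc j <? leaves u
...   | yes j+1<c rewrite dfsHang-left u v j j<c | dfsHang-left u v (suc j) j+1<c =
  s≤s (dfsHang-< u j j+1<c)
...   | no  j+1≮c = begin-strict
  dfsHang (node u v) j              ≡⟨ dfsHang-left u v j j<c ⟩
  suc (dfsHang u j)                 <⟨ n<1+n _ ⟩
  2 + dfsHang u j                   ≡⟨ 2+dfsHang-last u j j+1≡c ⟩
  2 * c                             ≤⟨ m≤m+n (2 * c) _ ⟩
  2 * c + dfsHang v 0               ≡⟨ dfsHang-right u v 0 ⟨
  dfsHang (node u v) (c + 0)        ≡⟨ cong (dfsHang (node u v)) (trans (+-identityʳ c) (sym j+1≡c)) ⟩
  dfsHang (node u v) (suc j)        ∎
  where
    open ≤-Reasoning
    c = leaves u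
    j+1≡c = ≤∧≮⇒≡ j<c j+1≮c

nth-applyUpTo : ∀ (f : ℕ → ℕ) n j → j < n → nth (applyUpTo f n) j ≡ just (f j)
nth-applyUpTo f (suc n) zero    _         = refl
nth-applyUpTo f (suc n) (suc j) (s≤s j<n) = nth-applyUpTo (f ∘ suc) n j j<n

take-applyUpTo : ∀ (f : ℕ → ℕ) m n → take m (applyUpTo f (m + n)) ≡ applyUpTo f m
take-applyUpTo f zero    n = refl
take-applyUpTo f (suc m) n = cong (f 0 ∷_) (take-applyUpTo (f ∘ suc) m n)

drop-applyUpTo : ∀ (f : ℕ → ℕ) m n → drop m (applyUpTo f (m + n)) ≡ applyUpTo (λ i → f (m + i)) n
drop-applyUpTo f zero    n = refl
drop-applyUpTo f (suc m) n = drop-applyUpTo (f ∘ suc) m n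

applyUpTo-cong : ∀ {f g : ℕ → ℕ} n → (∀ i → i < n → f i ≡ g i) → applyUpTo f n ≡ applyUpTo g n
applyUpTo-cong zero    f≗g = refl
applyUpTo-cong (suc n) f≗g = cong₂ _∷_ (f≗g 0 (s≤s z≤n)) (applyUpTo-cong n (λ i i<n → f≗g (suc i) (s≤s i<n)))

applyUpTo-increasing : ∀ (f : ℕ → ℕ) n → (∀ i → suc i < n → f i < f (suc i)) → Linked _<_ (applyUpTo f n)
applyUpTo-increasing f zero          _   = []
applyUpTo-increasing f (suc zero)    _   = [-]
applyUpTo-increasing f (suc (suc n)) inc =
  inc 0 (s≤s (s≤s z≤n)) ∷ applyUpTo-increasing (f ∘ suc) (suc n) (λ i i+1<n → inc (suc i) (s≤s i+1<n))

2*[1+n]∸2≡2*n : ∀ n → 2 * suc n ∸ 2 ≡ 2 * n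
2*[1+n]∸2≡2*n n = cong (_∸ 2) (*-suc 2 n)

above-split : ∀ {j x} → 2 * j < x → suc (suc x) ≢ 2 * suc (suc j) ∸ 2
above-split {j} 2j<x eq =
  <⇒≢ 2j<x (sym (suc-injective (suc-injective (trans eq (trans (2*[1+n]∸2≡2*n (suc j)) (*-suc 2 j))))))

-- (s₂, …, s_{n+1}) with s_{j+2} = 1 + dfsHang t j: the W-sequence of t with an
-- edge planted above its root, ordering the free end of that edge first and
-- then the leaves depth-first.
plantedWseq : Tree → List ℕ
plantedWseq t = applyUpTo (suc ∘ dfsHang t) (leaves t)

plantedWseq-downSplit : ∀ t → DownSplit (plantedWseq t)
plantedWseq-downSplit leaf       = base
plantedWseq-downSplit (node u v) =
  split s (suc c) (s≤s (leaves-pos u)) k<m valueAtSplit noEarlierSplit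
    (subst DownSplit (sym leftPart) (plantedWseq-downSplit u))
    (subst DownSplit (sym rightPart) (plantedWseq-downSplit v))
  where
    open ≡-Reasoning
    c = leaves u
    e = leaves v
    f = suc ∘ dfsHang (node u v)
    s = plantedWseq (node u v)
    c-1 = c ∸ 1
    c-1+1≡c : suc c-1 ≡ c
    c-1+1≡c = trans (+-comm 1 c-1) (m∸n+n≡m (leaves-pos u))
    k<m : suc c < suc (length s)
    k<m = s≤s (subst (c <_) (sym (length-applyUpTo f (c + e))) (m<m+n c (leaves-pos v)))
    valueAtSplit : nth s c-1 ≡ just (2 * suc c ∸ 2)
    valueAtSplit = begin
      nth s c-1                     ≡⟨ nth-applyUpTo f (c + e) c-1 (≤-trans (≤-reflexive c-1+1≡c) (m≤m+n c e)) ⟩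
      just (f c-1)                  ≡⟨ cong (just ∘ suc) (dfsHang-left u v c-1 (≤-reflexive c-1+1≡c)) ⟩
      just (2 + dfsHang u c-1)      ≡⟨ cong just (2+dfsHang-last u c-1 c-1+1≡c) ⟩
      just (2 * c)                  ≡⟨ cong just (2*[1+n]∸2≡2*n c) ⟨
      just (2 * suc c ∸ 2)          ∎
    noEarlierSplit : ∀ j → 2 ≤ j → j < suc c → nth s (j ∸ 2) ≢ just (2 * j ∸ 2)
    noEarlierSplit (suc (suc j)) (s≤s (s≤s _)) (s≤s j+1<c) eq = above-split (2*j<dfsHang u j j+1<c) (begin
      2 + dfsHang u j               ≡⟨ cong suc (dfsHang-left u v j j<c) ⟨
      f j                           ≡⟨ just-injective (trans (sym (nth-applyUpTo f (c + e) j (≤-trans j<c (m≤m+n c e)))) eq) ⟩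
      2 * suc (suc j) ∸ 2           ∎)
      where j<c = ≤-trans (n≤1+n _) j+1<c
    leftPart : map (_∸ 1) (take c s) ≡ plantedWseq u
    leftPart = begin
      map (_∸ 1) (take c s)                     ≡⟨ cong (map (_∸ 1)) (take-applyUpTo f c e) ⟩
      map (_∸ 1) (applyUpTo f c)                ≡⟨ map-applyUpTo f (_∸ 1) c ⟩
      applyUpTo (dfsHang (node u v)) c          ≡⟨ applyUpTo-cong c (dfsHang-left u v) ⟩
      plantedWseq u                             ∎
    rightPart : map (_∸ (2 * suc c ∸ 2)) (drop c s) ≡ plantedWseq v
    rightPart = begin
      map (_∸ (2 * suc c ∸ 2)) (drop c s)                      ≡⟨ cong (map (_∸ (2 * suc c ∸ 2))) (drop-applyUpTo f c e) ⟩
      map (_∸ (2 * suc c ∸ 2)) (applyUpTo (λ i → f (c + i)) e)  ≡⟨ map-applyUpTo (λ i → f (c + i)) (_∸ (2 * suc c ∸ 2)) e ⟩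
      applyUpTo (λ i → f (c + i) ∸ (2 * suc c ∸ 2)) e           ≡⟨ applyUpTo-cong e (λ i _ → shifted i) ⟩
      plantedWseq v                                            ∎
      where
        shifted : ∀ i → f (c + i) ∸ (2 * suc c ∸ 2) ≡ suc (dfsHang v i)
        shifted i = begin
          suc (dfsHang (node u v) (c + i)) ∸ (2 * suc c ∸ 2) ≡⟨ cong₂ _∸_ (cong suc (dfsHang-right u v i)) (2*[1+n]∸2≡2*n c) ⟩
          suc (2 * c + dfsHang v i) ∸ 2 * c                 ≡⟨ cong (_∸ 2 * c) (+-suc (2 * c) (dfsHang v i)) ⟨
          2 * c + suc (dfsHang v i) ∸ 2 * c                 ≡⟨ m+n∸m≡n (2 * c) _ ⟩
          suc (dfsHang v i)                                 ∎

upSplit-planted : ∀ t → UpSplit (0 ∷ applyUpTo (λ i → 2 + dfsHang t i) (leaves t))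
upSplit-planted t =
  split s 1 (applyUpTo-increasing f (suc n) increasing) (s≤s z≤n)
    (s≤s (subst (1 ≤_) (sym (length-applyUpTo (f ∘ suc) n)) (leaves-pos t))) refl noLaterSplit
    base (subst DownSplit (sym (map-applyUpTo (f ∘ suc) (_∸ 1) n)) (plantedWseq-downSplit t))
  where
    n = leaves t
    f : ℕ → ℕ
    f zero    = 0
    f (suc i) = 2 + dfsHang t i
    s = applyUpTo f (suc n)
    increasing : ∀ i → suc i < suc n → f i < f (suc i)
    increasing zero    _             = s≤s z≤n
    increasing (suc i) (s≤s i+1<n)   = s≤s (s≤s (dfsHang-< t i i+1<n))
    noLaterSplit : ∀ j → 1 < j → j < length s → nth s (j ∸ 1) ≢ just (2 * j ∸ 2)
    noLaterSplit (suc (suc j)) (s≤s (s≤s _)) (s≤s j+1<|s|) eq =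
      above-split (2*j<dfsHang t j j+1<n)
        (just-injective (trans (sym (nth-applyUpTo (f ∘ suc) n j (≤-trans (n≤1+n _) j+1<n))) eq))
      where j+1<n = subst (suc j <_) (length-applyUpTo (f ∘ suc) n) j+1<|s|

-- Re-rooting

-- node l r and node leaf (rotate l r) are the same unrooted tree, the lone
-- leaf of the latter being the leftmost leaf of l.
rotate : Tree → Tree → Tree
rotate leaf       r = r
rotate (node a b) r = rotate a (node r b)

leaves-rotate : ∀ l r → leaves l + leaves r ≡ suc (leaves (rotate l r))
leaves-rotate leaf       r = refl
leaves-rotate (node a b) r = trans regroup (leaves-rotate a (node r b))
  where
    regroup : leaves a + leaves b + leaves r ≡ leaves a + (leaves r + leaves b)
    regroup = trans (+-assoc (leaves a) _ _) (cong (leaves a +_) (+-comm (leaves b) _))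

reassociate : ∀ {a b c} → Leaf (node (node a b) c) ↔ Leaf (node a (node c b))
reassociate = mk↔ₛ′ φ ψ φψ ψφ
  where
    φ : ∀ {a b c} → Leaf (node (node a b) c) → Leaf (node a (node c b))
    φ (left (left y))  = left y
    φ (left (right y)) = right (right y)
    φ (right y)        = right (left y)
    ψ : ∀ {a b c} → Leaf (node a (node c b)) → Leaf (node (node a b) c)
    ψ (left y)          = left (left y)
    ψ (right (right y)) = left (right y)
    ψ (right (left y))  = right y
    φψ : ∀ {a b c} (y : Leaf (node a (node c b))) → φ {a} {b} {c} (ψ y) ≡ y
    φψ (left y)          = refl
    φψ (right (right y)) = refl
    φψ (right (left y))  = refl
    ψφ : ∀ {a b c} (y : Leaf (node (node a b) c)) → ψ (φ y) ≡ y
    ψφ (left (left y))  = refl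
    ψφ (left (right y)) = refl
    ψφ (right y)        = refl

-- Once the leaf set meets both a and c, the roots of both trees lie on the
-- spanned subtree, which is then the same in both.
span-reassociate : ∀ a b c (K : Leaf (node a (node c b)) → Bool) x z →
  K (left x) ≡ true → K (right (left z)) ≡ true →
  span (node (node a b) c) (K ∘ to reassociate) ≡ span (node a (node c b)) K
span-reassociate a b c K x z Kx Kz = begin
  span (node (node a b) c) K′
    ≡⟨ span-both (node a b) c K′ (anyLeaf-true (node a b) (K′ ∘ left) (left x) Kx) inC ⟩
  suc (hang (node a b) (K′ ∘ left)) + suc C
    ≡⟨ cong (λ h → suc h + suc C) (hang-leftNonempty a b (K′ ∘ left) inA) ⟩
  suc (suc A + B) + suc C
    ≡⟨ shuffle A B C ⟩
  suc A + suc (suc C + B)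
    ≡⟨ cong (λ h → suc A + suc h) (hang-leftNonempty c b (K ∘ right) inC) ⟨
  suc A + suc (hang (node c b) (K ∘ right))
    ≡⟨ span-both a (node c b) K inA (anyLeaf-true (node c b) (K ∘ right) (left z) Kz) ⟨
  span (node a (node c b)) K ∎
  where
    open ≡-Reasoning
    K′ = K ∘ to reassociate
    A = hang a (K ∘ left)
    C = hang c (K ∘ right ∘ left)
    B = edgeIf (anyLeaf b (K ∘ right ∘ right)) (hang b (K ∘ right ∘ right))
    inA = anyLeaf-true a (K ∘ left) x Kx
    inC = anyLeaf-true c (K ∘ right ∘ left) z Kz
    shuffle : ∀ A B C → suc (suc A + B) + suc C ≡ suc A + suc (suc C + B)
    shuffle = solve-∀

rotateLeaves : ∀ l r → Leaf (node l r) ↔ Leaf (node leaf (rotate l r))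
rotateLeaves leaf       r = ↔-id _
rotateLeaves (node a b) r = rotateLeaves a (node r b) ↔-∘ reassociate

rotateLeaves-left : ∀ l r → to (rotateLeaves l r) (left (leftmost l)) ≡ left here
rotateLeaves-left leaf       r = refl
rotateLeaves-left (node a b) r = rotateLeaves-left a (node r b)

rotateLeaves-right : ∀ l r → to (rotateLeaves l r) (right (leftmost r)) ≡ right (leftmost (rotate l r))
rotateLeaves-right leaf       r = refl
rotateLeaves-right (node a b) r = rotateLeaves-right a (node r b)

span-rotate : ∀ l r (K : Leaf (node leaf (rotate l r)) → Bool) →
  K (left here) ≡ true → K (right (leftmost (rotate l r))) ≡ true →
  span (node l r) (K ∘ to (rotateLeaves l r)) ≡ span (node leaf (rotate l r)) K
span-rotate leaf       r K _   _   = refl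
span-rotate (node a b) r K Kl₀ Kr₀ =
  trans (span-reassociate a b r (K ∘ to ρ) (leftmost a) (leftmost r)
           (trans (cong K (rotateLeaves-left a (node r b))) Kl₀)
           (trans (cong K (rotateLeaves-right a (node r b))) Kr₀))
        (span-rotate a (node r b) K Kl₀ Kr₀)
  where ρ = rotateLeaves a (node r b)

ordering : ∀ l r → Fin (leaves (node l r)) ↔ Leaf (node l r)
ordering l r = ↔-sym (rotateLeaves l r) ↔-∘ (dfs (node leaf (rotate l r)) ↔-∘ castIso)
  where
    eq = leaves-rotate l r
    castIso : Fin (leaves (node l r)) ↔ Fin (suc (leaves (rotate l r)))
    castIso = mk↔ₛ′ (Fin.cast eq) (Fin.cast (sym eq)) (cast-involutive eq (sym eq)) (cast-involutive (sym eq) eq)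

span-ordering : ∀ l r j →
  span (node l r) (firstK (node l r) (ordering l r) (2 + j)) ≡ 2 + dfsHang (rotate l r) j
span-ordering l r j = begin
  span (node l r) (firstK (node l r) (ordering l r) (2 + j))
    ≡⟨ span-cong (node l r) (λ y → cong (_<ᵇ 2 + j) (trans (toℕ-cast (sym (leaves-rotate l r)) (from (dfs T) (to ρ y))) (toℕ-dfsFrom T (to ρ y)))) ⟩
  span (node l r) (K ∘ to ρ)
    ≡⟨ span-rotate l r K refl (leftmost∈dfsPrefix Q j) ⟩
  span T K
    ≡⟨ span-both leaf Q K refl (anyLeaf-dfsPrefix Q j) ⟩
  2 + dfsHang Q j ∎
  where
    open ≡-Reasoning
    Q = rotate l r
    T = node leaf Q
    ρ = rotateLeaves l r
    K = dfsPrefix T (2 + j)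

Wseq-ordering : ∀ l r → Wseq (node l r) (ordering l r) ≡ applyUpTo (λ i → 2 + dfsHang (rotate l r) i) (leaves (rotate l r))
Wseq-ordering l r = begin
  Wseq (node l r) (ordering l r)
    ≡⟨ map-upTo W (leaves l + leaves r ∸ 1) ⟩
  applyUpTo W (leaves l + leaves r ∸ 1)
    ≡⟨ cong (applyUpTo W ∘ (_∸ 1)) (leaves-rotate l r) ⟩
  applyUpTo W (leaves (rotate l r))
    ≡⟨ applyUpTo-cong _ (λ j _ → span-ordering l r j) ⟩
  applyUpTo (λ i → 2 + dfsHang (rotate l r) i) (leaves (rotate l r)) ∎
  where
    open ≡-Reasoning
    W = λ i → span (node l r) (firstK (node l r) (ordering l r) (2 + i))

lemma6p16 : (l r : Tree) →
    ∃ λ (σ : Fin (leaves (node l r)) ↔ Leaf (node l r)) →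
      UpSplit (0 ∷ Wseq (node l r) σ)
lemma6p16 l r =
  ordering l r , subst (UpSplit ∘ (0 ∷_)) (sym (Wseq-ordering l r)) (upSplit-planted (rotate l r))
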